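{- Let $G$ be a finite simple graph. The spectrum of the adjacency matrix of the triangular signed graph $G_{\vartriangle}$ does not depend on the orientation of $G$ (neither on the orientation of its edges nor on the chosen cyclic orientations of its triangles).
   Context: Each edge of $G$ is given a direction and each triangle $\vartriangle$ of $G$ is given a cyclic orientation; for an edge $e$ of $\vartriangle$, write $e\in\vartriangle^+$ if the orientation of $e$ agrees with that of $\vartriangle$, and $e\in\vartriangle^-$ otherwise. The triangular signed graph $G_{\vartriangle}$ has the triangles of $G$ as vertices; two distinct triangles $\vartriangle_1,\vartriangle_2$ sharing an edge $e$ are joined by a positive edge if $e\in\vartriangle_1^+\cap\vartriangle_2^+$ or $e\in\vartriangle_1^-\cap\vartriangle_2^-$, and by a negative edge if $e$ lies in $\vartriangle_1^+$ and $\vartriangle_2^-$ or in $\vartriangle_1^-$ and $\vartriangle_2^+$; triangles sharing no edge are nonadjacent. Its adjacency matrix has entry $\pm1$ for positive/negative edges and $0$ otherwise. -}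

module Defs where

open import Data.Bool using (Bool; true; false; _∧_; _∨_; not; if_then_else_)
open import Data.Nat using (ℕ; zero; suc) renaming (_<ᵇ_ to _<ℕᵇ_)
open import Data.Fin using (Fin; zero; suc; toℕ; punchIn; _≟_)
open import Data.Integer using (ℤ; 0ℤ; 1ℤ; -1ℤ; -_) renaming (_+_ to _+ℤ_; _*_ to _*ℤ_)
open import Data.List using (List; []; _∷_; length; allFin; concatMap; filterᵇ; lookup)
open import Data.Maybe using (Maybe; just; nothing)
open import Data.Product using (_×_; _,_)
open import Relation.Nullary using (does)
open import Relation.Binary.PropositionalEquality using (_≡_)

record SimpleGraph (n : ℕ) : Set where
  field
    adj    : Fin n → Fin n → Bool
    sym    : ∀ u v → adj u v ≡ adj v u
    irrefl : ∀ u → adj u u ≡ false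
open SimpleGraph public

_==_ : ∀ {n} → Fin n → Fin n → Bool
x == y = does (x ≟ y)

_<ᵇ_ : ∀ {n} → Fin n → Fin n → Bool
x <ᵇ y = toℕ x <ℕᵇ toℕ y

Triple : ℕ → Set
Triple n = Fin n × Fin n × Fin n

-- a triangle {a,b,c} is represented uniquely by its vertices listed with a < b < c
isTriangle : ∀ {n} → SimpleGraph n → Triple n → Bool
isTriangle G (a , b , c) =
  (a <ᵇ b) ∧ (b <ᵇ c) ∧ adj G a b ∧ adj G b c ∧ adj G a c

allTriples : ∀ n → List (Triple n)
allTriples n =
  concatMap (λ a → concatMap (λ b → Data.List.map (λ c → (a , b , c)) (allFin n)) (allFin n)) (allFin n)

triangles : ∀ {n} → SimpleGraph n → List (Triple n)
triangles {n} G = filterᵇ (isTriangle G) (allTriples n)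

-- number of triangles = number of vertices of G_△
numTri : ∀ {n} → SimpleGraph n → ℕ
numTri G = length (triangles G)

tri : ∀ {n} (G : SimpleGraph n) → Fin (numTri G) → Triple n
tri G i = lookup (triangles G) i

-- direction of each edge: dir u v = true means the edge {u,v} is directed u → v
record EdgeOrientation {n : ℕ} (G : SimpleGraph n) : Set where
  field
    dir     : Fin n → Fin n → Bool
    antisym : ∀ u v → adj G u v ≡ true → dir u v ≡ not (dir v u)
open EdgeOrientation public

-- cyclic orientation of each triangle (a,b,c) with a<b<c:
-- true means a → b → c → a, false means a → c → b → a
TriOrientation : ∀ {n} → SimpleGraph n → Set
TriOrientation G = Fin (numTri G) → Bool

cycStep : ∀ {n} → Triple n → Bool → Fin n → Fin n → Bool
cycStep (a , b , c) o u v =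
  if o then fwd u v else fwd v u
  where
  fwd : _ → _ → Bool
  fwd x y = (x == a ∧ y == b) ∨ (x == b ∧ y == c) ∨ (x == c ∧ y == a)

-- e = {u,v} ∈ △⁺  (true)  or  e ∈ △⁻ (false)
inPlus : ∀ {n} {G : SimpleGraph n} → EdgeOrientation G → Triple n → Bool → Fin n → Fin n → Bool
inPlus d t o u v = if dir d u v then cycStep t o u v else cycStep t o v u

memT : ∀ {n} → Triple n → Fin n → Bool
memT (a , b , c) x = x == a ∨ x == b ∨ x == c

sharedEdge : ∀ {n} → Triple n → Triple n → Maybe (Fin n × Fin n)
sharedEdge (a , b , c) t₂ =
  if memT t₂ a ∧ memT t₂ b then just (a , b)
  else if memT t₂ b ∧ memT t₂ c then just (b , c)
  else if memT t₂ a ∧ memT t₂ c then just (a , c)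
  else nothing

_==ᵇ_ : Bool → Bool → Bool
true ==ᵇ y = y
false ==ᵇ y = not y

triAdj : ∀ {n} (G : SimpleGraph n) → EdgeOrientation G → TriOrientation G →
         Fin (numTri G) → Fin (numTri G) → ℤ
triAdj G d o i j with i == j | sharedEdge (tri G i) (tri G j)
... | true  | _ = 0ℤ
... | false | nothing = 0ℤ
... | false | just (u , v) =
  if inPlus d (tri G i) (o i) u v ==ᵇ inPlus d (tri G j) (o j) u v then 1ℤ else -1ℤ

-- Integer polynomials (coefficient lists, lowest degree first)

Poly : Set
Poly = List ℤ

_+P_ : Poly → Poly → Poly
[] +P q = q
(a ∷ p) +P [] = a ∷ p
(a ∷ p) +P (b ∷ q) = (a +ℤ b) ∷ (p +P q)

scaleP : ℤ → Poly → Poly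
scaleP c = Data.List.map (c *ℤ_)

_*P_ : Poly → Poly → Poly
[] *P q = []
(a ∷ p) *P q = scaleP a q +P (0ℤ ∷ (p *P q))

negP : Poly → Poly
negP = scaleP -1ℤ

constP : ℤ → Poly
constP c = c ∷ []

varX : Poly
varX = 0ℤ ∷ 1ℤ ∷ []

coeff : Poly → ℕ → ℤ
coeff [] _ = 0ℤ
coeff (a ∷ p) zero = a
coeff (a ∷ p) (suc k) = coeff p k

-- equality of polynomials (ignoring trailing zero coefficients)
_≈P_ : Poly → Poly → Set
p ≈P q = ∀ k → coeff p k ≡ coeff q k

sumP : ∀ {k} → (Fin k → Poly) → Poly
sumP {zero} f = []
sumP {suc k} f = f zero +P sumP (λ j → f (suc j))

altSign : ℕ → ℤ
altSign zero = 1ℤ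
altSign (suc m) = - altSign m

det : ∀ k → (Fin k → Fin k → Poly) → Poly
det zero M = constP 1ℤ
det (suc k) M =
  sumP (λ j → scaleP (altSign (toℕ j)) (M zero j *P det k (λ r s → M (suc r) (punchIn j s))))

charPoly : ∀ {m} → (Fin m → Fin m → ℤ) → Poly
charPoly {m} A = det m (λ i j → (if i == j then varX else []) +P negP (constP (A i j)))

{-# OPTIONS --safe #-}

-- Reversing the direction of an edge e flips the membership of e in △⁺ / △⁻
-- for both triangles containing it, so the sign of the entry of G_△ carried
-- by e does not change.  Reversing the cyclic orientation of a triangle
-- negates its whole row and column.  Hence, writing σ(△) = ±1 for the
-- orientation of △ relative to the reference one a → b → c (a < b < c), the
-- adjacency matrix is S R S with S = diag σ and R independent of all
-- orientations; since S² = 1, det (x I − S R S) = det (S (x I − R) S) =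
-- det (x I − R).
module Submission where

open import Defs hiding (sym)
open import Data.Bool using (Bool; true; false; T; not; _∧_; if_then_else_)
open import Data.Bool.Properties using (not-involutive; ¬-not; T-∧)
open import Data.Fin using (Fin; zero; suc; toℕ; punchIn; _≟_)
open import Data.Fin.Properties using (<⇒≢; <-trans)
open import Data.Integer using (ℤ; 0ℤ; 1ℤ; -1ℤ; _*_)
open import Data.Integer.Properties
  using (*-identityˡ; *-zeroʳ; *-distribˡ-+; *-assoc; *-comm; *-commutativeSemigroup; *-1-commutativeMonoid)
open import Algebra.Properties.CommutativeSemigroup *-commutativeSemigroup using (interchange; x∙yz≈y∙xz)
open import Algebra.Properties.CommutativeMonoid.Sum *-1-commutativeMonoid
  using ()
  renaming (sum to ∏; sum-remove to ∏-remove; ∑-distrib-+ to ∏-distrib-*; sum-cong-≗ to ∏-cong; sum-replicate-zero to ∏-ones)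
open import Data.List using ([]; _∷_)
open import Data.List.Properties using (map-∘; map-cong; map-id)
open import Data.List.Membership.Propositional.Properties using (∈-lookup; ∈-filter⁻)
open import Data.Maybe using (just; nothing)
open import Data.Nat using (zero; suc)
open import Data.Nat.Properties using (<ᵇ⇒<)
open import Data.Product using (_×_; _,_; proj₂)
open import Data.Sum using (_⊎_; inj₁; inj₂)
open import Data.Vec.Functional using (removeAt)
open import Function using (_∘_; Equivalence)
open import Relation.Nullary using (yes; no; contradiction)
open import Relation.Nullary.Decidable using (dec-true; dec-false; T?)
open import Relation.Binary.PropositionalEquality
  using (_≡_; _≢_; refl; sym; trans; cong; cong₂; ≢-sym; module ≡-Reasoning)

open ≡-Reasoning

Distinct : ∀ {n} → Triple n → Set
Distinct (a , b , c) = a ≢ b × b ≢ c × a ≢ c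

_∈ₜ_ : ∀ {n} → Fin n → Triple n → Set
x ∈ₜ (a , b , c) = x ≡ a ⊎ x ≡ b ⊎ x ≡ c

record EdgeOf {n} (t : Triple n) (u v : Fin n) : Set where
  constructor edge
  field
    u∈t : u ∈ₜ t
    v∈t : v ∈ₜ t
    u≢v : u ≢ v

isTriangle⇒Distinct : ∀ {n} (G : SimpleGraph n) t → T (isTriangle G t) → Distinct t
isTriangle⇒Distinct G (a , b , c) isT
  with a<bᵇ , rest ← Equivalence.to T-∧ isT
  with b<cᵇ , _    ← Equivalence.to T-∧ rest
  = let a<b = <ᵇ⇒< (toℕ a) (toℕ b) a<bᵇ
        b<c = <ᵇ⇒< (toℕ b) (toℕ c) b<cᵇ
    in <⇒≢ a<b , <⇒≢ b<c , <⇒≢ (<-trans a<b b<c)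

tri-distinct : ∀ {n} (G : SimpleGraph n) i → Distinct (tri G i)
tri-distinct {n} G i =
  isTriangle⇒Distinct G (tri G i) (proj₂ (∈-filter⁻ (T? ∘ isTriangle G) {xs = allTriples n} (∈-lookup i)))

memT⇒∈ₜ : ∀ {n} {x : Fin n} t → memT t x ≡ true → x ∈ₜ t
memT⇒∈ₜ {x = x} (a , b , c) x∈t with x ≟ a | x ≟ b | x ≟ c
... | yes x≡a | _        | _        = inj₁ x≡a
... | no _    | yes x≡b  | _        = inj₂ (inj₁ x≡b)
... | no _    | no _     | yes x≡c  = inj₂ (inj₂ x≡c)
memT⇒∈ₜ (a , b , c) () | no _ | no _ | no _

∧-true : ∀ {x y} → x ∧ y ≡ true → x ≡ true × y ≡ true
∧-true {true} {true} refl = refl , refl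

memT-edge : ∀ {n} (t : Triple n) {u v} → memT t u ∧ memT t v ≡ true → u ≢ v → EdgeOf t u v
memT-edge t uv∈t u≢v = let u∈t , v∈t = ∧-true uv∈t in edge (memT⇒∈ₜ t u∈t) (memT⇒∈ₜ t v∈t) u≢v

sharedEdge-sound : ∀ {n} {t₁ t₂ : Triple n} {u v} → Distinct t₁ →
  sharedEdge t₁ t₂ ≡ just (u , v) → EdgeOf t₁ u v × EdgeOf t₂ u v
sharedEdge-sound {t₁ = a , b , c} {t₂} (a≢b , b≢c , a≢c) shared
  with memT t₂ a ∧ memT t₂ b in ab∈t₂
... | true with refl ← shared =
  edge (inj₁ refl) (inj₂ (inj₁ refl)) a≢b , memT-edge t₂ ab∈t₂ a≢b
... | false with memT t₂ b ∧ memT t₂ c in bc∈t₂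
...   | true with refl ← shared =
  edge (inj₂ (inj₁ refl)) (inj₂ (inj₂ refl)) b≢c , memT-edge t₂ bc∈t₂ b≢c
...   | false with memT t₂ a ∧ memT t₂ c in ac∈t₂
...     | true with refl ← shared =
  edge (inj₁ refl) (inj₂ (inj₂ refl)) a≢c , memT-edge t₂ ac∈t₂ a≢c
sharedEdge-sound _ () | false | false | false

cycStep-reverse-table : ∀ {n} {a b c : Fin n} → Distinct (a , b , c) →
  let step = cycStep (a , b , c) true in
  step b a ≢ step a b × step c b ≢ step b c × step a c ≢ step c a
cycStep-reverse-table {a = a} {b} {c} (a≢b , b≢c , a≢c)
  rewrite dec-true (a ≟ a) refl | dec-true (b ≟ b) refl | dec-true (c ≟ c) refl
        | dec-false (a ≟ b) a≢b | dec-false (b ≟ c) b≢c | dec-false (a ≟ c) a≢c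
        | dec-false (b ≟ a) (≢-sym a≢b) | dec-false (c ≟ b) (≢-sym b≢c) | dec-false (c ≟ a) (≢-sym a≢c)
  = (λ ()) , (λ ()) , (λ ())

cycStep-reverse : ∀ {n} {t : Triple n} {u v} → Distinct t → EdgeOf t u v →
  cycStep t true v u ≡ not (cycStep t true u v)
cycStep-reverse distinct (edge u∈t v∈t u≢v) with cycStep-reverse-table distinct | u∈t | v∈t
... | ba≢ab , _     , _     | inj₁ refl        | inj₂ (inj₁ refl) = ¬-not ba≢ab
... | ba≢ab , _     , _     | inj₂ (inj₁ refl) | inj₁ refl        = ¬-not (≢-sym ba≢ab)
... | _     , cb≢bc , _     | inj₂ (inj₁ refl) | inj₂ (inj₂ refl) = ¬-not cb≢bc
... | _     , cb≢bc , _     | inj₂ (inj₂ refl) | inj₂ (inj₁ refl) = ¬-not (≢-sym cb≢bc)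
... | _     , _     , ac≢ca | inj₂ (inj₂ refl) | inj₁ refl        = ¬-not ac≢ca
... | _     , _     , ac≢ca | inj₁ refl        | inj₂ (inj₂ refl) = ¬-not (≢-sym ac≢ca)
... | _ | inj₁ refl        | inj₁ refl        = contradiction refl u≢v
... | _ | inj₂ (inj₁ refl) | inj₂ (inj₁ refl) = contradiction refl u≢v
... | _ | inj₂ (inj₂ refl) | inj₂ (inj₂ refl) = contradiction refl u≢v

inPlus-==ᵇ : ∀ {n} {G : SimpleGraph n} (d : EdgeOrientation G) {t : Triple n} {u v} →
  Distinct t → EdgeOf t u v → ∀ o →
  inPlus d t o u v ≡ dir d u v ==ᵇ (o ==ᵇ cycStep t true u v)
inPlus-==ᵇ d {u = u} {v} distinct e o with dir d u v | o
... | true  | true  = refl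
... | true  | false = cycStep-reverse distinct e
... | false | true  = cycStep-reverse distinct e
... | false | false = sym (not-involutive _)

sgn : Bool → ℤ
sgn b = if b then 1ℤ else -1ℤ

sgn-==ᵇ : ∀ x y → sgn (x ==ᵇ y) ≡ sgn x * sgn y
sgn-==ᵇ true  true  = refl
sgn-==ᵇ true  false = refl
sgn-==ᵇ false true  = refl
sgn-==ᵇ false false = refl

sgn-square : ∀ b → sgn b * sgn b ≡ 1ℤ
sgn-square true  = refl
sgn-square false = refl

referenceTriAdj : ∀ {n} (G : SimpleGraph n) → Fin (numTri G) → Fin (numTri G) → ℤ
referenceTriAdj G i j with i == j | sharedEdge (tri G i) (tri G j)
... | true  | _ = 0ℤ
... | false | nothing = 0ℤ
... | false | just (u , v) = sgn (cycStep (tri G i) true u v) * sgn (cycStep (tri G j) true u v)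

triAdj-switching : ∀ {n} (G : SimpleGraph n) (d : EdgeOrientation G) (o : TriOrientation G) i j →
  triAdj G d o i j ≡ sgn (o i) * sgn (o j) * referenceTriAdj G i j
triAdj-switching G d o i j with i == j | sharedEdge (tri G i) (tri G j) in shared
... | true  | _       = sym (*-zeroʳ (sgn (o i) * sgn (o j)))
... | false | nothing = sym (*-zeroʳ (sgn (o i) * sgn (o j)))
... | false | just (u , v) with eᵢ , eⱼ ← sharedEdge-sound (tri-distinct G i) shared = begin
  sgn (pᵢ ==ᵇ pⱼ)       ≡⟨ sgn-==ᵇ pᵢ pⱼ ⟩
  sgn pᵢ * sgn pⱼ       ≡⟨ cong₂ _*_ (sgn-inPlus i eᵢ) (sgn-inPlus j eⱼ) ⟩
  (δ * xᵢ) * (δ * xⱼ)   ≡⟨ interchange δ xᵢ δ xⱼ ⟩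
  (δ * δ) * (xᵢ * xⱼ)   ≡⟨ cong (_* (xᵢ * xⱼ)) (sgn-square (dir d u v)) ⟩
  1ℤ * (xᵢ * xⱼ)        ≡⟨ *-identityˡ (xᵢ * xⱼ) ⟩
  (σᵢ * τᵢ) * (σⱼ * τⱼ) ≡⟨ interchange σᵢ τᵢ σⱼ τⱼ ⟩
  σᵢ * σⱼ * (τᵢ * τⱼ)   ∎
  where
  pᵢ = inPlus d (tri G i) (o i) u v
  pⱼ = inPlus d (tri G j) (o j) u v
  δ  = sgn (dir d u v)
  σᵢ = sgn (o i)
  σⱼ = sgn (o j)
  τᵢ = sgn (cycStep (tri G i) true u v)
  τⱼ = sgn (cycStep (tri G j) true u v)
  xᵢ = σᵢ * τᵢ
  xⱼ = σⱼ * τⱼ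
  sgn-inPlus : ∀ k → EdgeOf (tri G k) u v →
    sgn (inPlus d (tri G k) (o k) u v) ≡ δ * (sgn (o k) * sgn (cycStep (tri G k) true u v))
  sgn-inPlus k e = begin
    sgn (inPlus d (tri G k) (o k) u v)
      ≡⟨ cong sgn (inPlus-==ᵇ d (tri-distinct G k) e (o k)) ⟩
    sgn (dir d u v ==ᵇ (o k ==ᵇ cycStep (tri G k) true u v))
      ≡⟨ trans (sgn-==ᵇ (dir d u v) _) (cong (δ *_) (sgn-==ᵇ (o k) _)) ⟩
    δ * (sgn (o k) * sgn (cycStep (tri G k) true u v)) ∎

scaleP-+P : ∀ a p q → scaleP a (p +P q) ≡ scaleP a p +P scaleP a q
scaleP-+P a []      q       = refl
scaleP-+P a (x ∷ p) []      = refl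
scaleP-+P a (x ∷ p) (y ∷ q) = cong₂ _∷_ (*-distribˡ-+ a x y) (scaleP-+P a p q)

scaleP-scaleP : ∀ a b p → scaleP a (scaleP b p) ≡ scaleP (a * b) p
scaleP-scaleP a b p = trans (sym (map-∘ p)) (map-cong (λ x → sym (*-assoc a b x)) p)

scaleP-comm : ∀ a b p → scaleP a (scaleP b p) ≡ scaleP b (scaleP a p)
scaleP-comm a b p = begin
  scaleP a (scaleP b p) ≡⟨ scaleP-scaleP a b p ⟩
  scaleP (a * b) p      ≡⟨ cong (λ c → scaleP c p) (*-comm a b) ⟩
  scaleP (b * a) p      ≡⟨ scaleP-scaleP b a p ⟨
  scaleP b (scaleP a p) ∎

scaleP-identity : ∀ p → scaleP 1ℤ p ≡ p
scaleP-identity p = trans (map-cong *-identityˡ p) (map-id p)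

scaleP-*Pˡ : ∀ a p q → scaleP a p *P q ≡ scaleP a (p *P q)
scaleP-*Pˡ a []      q = refl
scaleP-*Pˡ a (x ∷ p) q = begin
  scaleP (a * x) q +P (0ℤ ∷ (scaleP a p *P q))        ≡⟨ cong₂ _+P_ (sym (scaleP-scaleP a x q))
                                                                 (cong₂ _∷_ (sym (*-zeroʳ a)) (scaleP-*Pˡ a p q)) ⟩
  scaleP a (scaleP x q) +P scaleP a (0ℤ ∷ (p *P q))   ≡⟨ scaleP-+P a (scaleP x q) (0ℤ ∷ (p *P q)) ⟨
  scaleP a (scaleP x q +P (0ℤ ∷ (p *P q)))            ∎

scaleP-*Pʳ : ∀ a p q → p *P scaleP a q ≡ scaleP a (p *P q)
scaleP-*Pʳ a []      q = refl
scaleP-*Pʳ a (x ∷ p) q = begin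
  scaleP x (scaleP a q) +P (0ℤ ∷ (p *P scaleP a q))   ≡⟨ cong₂ _+P_ (scaleP-comm x a q)
                                                                 (cong₂ _∷_ (sym (*-zeroʳ a)) (scaleP-*Pʳ a p q)) ⟩
  scaleP a (scaleP x q) +P scaleP a (0ℤ ∷ (p *P q))   ≡⟨ scaleP-+P a (scaleP x q) (0ℤ ∷ (p *P q)) ⟨
  scaleP a (scaleP x q +P (0ℤ ∷ (p *P q)))            ∎

scaleP-*P-scaleP : ∀ a b p q → scaleP a p *P scaleP b q ≡ scaleP (a * b) (p *P q)
scaleP-*P-scaleP a b p q = begin
  scaleP a p *P scaleP b q     ≡⟨ scaleP-*Pˡ a p (scaleP b q) ⟩
  scaleP a (p *P scaleP b q)   ≡⟨ cong (scaleP a) (scaleP-*Pʳ b p q) ⟩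
  scaleP a (scaleP b (p *P q)) ≡⟨ scaleP-scaleP a b (p *P q) ⟩
  scaleP (a * b) (p *P q)      ∎

sumP-cong : ∀ {k} {f g : Fin k → Poly} → (∀ j → f j ≡ g j) → sumP f ≡ sumP g
sumP-cong {zero}  f≡g = refl
sumP-cong {suc k} f≡g = cong₂ _+P_ (f≡g zero) (sumP-cong (f≡g ∘ suc))

scaleP-sumP : ∀ {k} a (f : Fin k → Poly) → scaleP a (sumP f) ≡ sumP (scaleP a ∘ f)
scaleP-sumP {zero}  a f = refl
scaleP-sumP {suc k} a f =
  trans (scaleP-+P a (f zero) (sumP (f ∘ suc))) (cong (scaleP a (f zero) +P_) (scaleP-sumP a (f ∘ suc)))

minor : ∀ {k} → (Fin (suc k) → Fin (suc k) → Poly) → Fin (suc k) → Fin k → Fin k → Poly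
minor M j r s = M (suc r) (punchIn j s)

det-cong : ∀ k {M N : Fin k → Fin k → Poly} → (∀ i j → M i j ≡ N i j) → det k M ≡ det k N
det-cong zero    M≡N = refl
det-cong (suc k) M≡N = sumP-cong λ j →
  cong (scaleP (altSign (toℕ j))) (cong₂ _*P_ (M≡N zero j) (det-cong k λ r s → M≡N (suc r) (punchIn j s)))

det-scale-rows-cols : ∀ k (r c : Fin k → ℤ) (M : Fin k → Fin k → Poly) →
  det k (λ i j → scaleP (r i * c j) (M i j)) ≡ scaleP (∏ r * ∏ c) (det k M)
det-scale-rows-cols zero    r c M = refl
det-scale-rows-cols (suc k) r c M =
  trans (sumP-cong expand) (sym (scaleP-sumP (∏ r * ∏ c) (λ j → scaleP (altSign (toℕ j)) (M zero j *P det k (minor M j)))))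
  where
  expand : ∀ j →
    scaleP (altSign (toℕ j)) (scaleP (r zero * c j) (M zero j) *P
                              det k (λ r′ s → scaleP (r (suc r′) * c (punchIn j s)) (minor M j r′ s)))
    ≡ scaleP (∏ r * ∏ c) (scaleP (altSign (toℕ j)) (M zero j *P det k (minor M j)))
  expand j = begin
    scaleP ε (scaleP α p *P det k _)
      ≡⟨ cong (λ m → scaleP ε (scaleP α p *P m)) (det-scale-rows-cols k (r ∘ suc) (removeAt c j) (minor M j)) ⟩
    scaleP ε (scaleP α p *P scaleP β q)    ≡⟨ cong (scaleP ε) (scaleP-*P-scaleP α β p q) ⟩
    scaleP ε (scaleP (α * β) (p *P q))     ≡⟨ scaleP-comm ε (α * β) (p *P q) ⟩
    scaleP (α * β) (scaleP ε (p *P q))     ≡⟨ cong (λ γ → scaleP γ (scaleP ε (p *P q))) factors ⟩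
    scaleP (∏ r * ∏ c) (scaleP ε (p *P q)) ∎
    where
    ε = altSign (toℕ j)
    α = r zero * c j
    β = ∏ (r ∘ suc) * ∏ (removeAt c j)
    p = M zero j
    q = det k (minor M j)
    factors : α * β ≡ ∏ r * ∏ c
    factors = trans (interchange (r zero) (c j) (∏ (r ∘ suc)) (∏ (removeAt c j))) (cong (∏ r *_) (sym (∏-remove c)))

charMatrix : ∀ {m} → (Fin m → Fin m → ℤ) → Fin m → Fin m → Poly
charMatrix A i j = (if i == j then varX else []) +P negP (constP (A i j))

module _ {m} (s : Fin m → ℤ) (s²≡1 : ∀ i → s i * s i ≡ 1ℤ) where

  ∏-square : ∏ s * ∏ s ≡ 1ℤ
  ∏-square = begin
    ∏ s * ∏ s           ≡⟨ ∏-distrib-* s s ⟨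
    ∏ (λ i → s i * s i) ≡⟨ ∏-cong s²≡1 ⟩
    ∏ {m} (λ _ → 1ℤ)    ≡⟨ ∏-ones m ⟩
    1ℤ                  ∎

  module _ {A C : Fin m → Fin m → ℤ} (A≡sCs : ∀ i j → A i j ≡ s i * s j * C i j) where

    charMatrix-switching : ∀ i j → charMatrix A i j ≡ scaleP (s i * s j) (charMatrix C i j)
    charMatrix-switching i j with i ≟ j
    ... | yes refl rewrite A≡sCs i i | s²≡1 i | *-identityˡ (C i i) = sym (scaleP-identity _)
    ... | no _ = cong (_∷ []) (trans (cong (-1ℤ *_) (A≡sCs i j)) (x∙yz≈y∙xz -1ℤ (s i * s j) (C i j)))

    charPoly-switching : charPoly A ≡ charPoly C
    charPoly-switching = begin
      det m (charMatrix A)                                   ≡⟨ det-cong m charMatrix-switching ⟩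
      det m (λ i j → scaleP (s i * s j) (charMatrix C i j))  ≡⟨ det-scale-rows-cols m s s (charMatrix C) ⟩
      scaleP (∏ s * ∏ s) (det m (charMatrix C))              ≡⟨ cong (λ a → scaleP a (det m (charMatrix C))) ∏-square ⟩
      scaleP 1ℤ (det m (charMatrix C))                       ≡⟨ scaleP-identity (det m (charMatrix C)) ⟩
      det m (charMatrix C)                                   ∎

corollary5p2 : ∀ {n} (G : SimpleGraph n) (d₁ d₂ : EdgeOrientation G) (o₁ o₂ : TriOrientation G) →
    charPoly (triAdj G d₁ o₁) ≈P charPoly (triAdj G d₂ o₂)
corollary5p2 G d₁ d₂ o₁ o₂ k = cong (λ p → coeff p k) (begin
  charPoly (triAdj G d₁ o₁)    ≡⟨ charPoly-switching (sgn ∘ o₁) (sgn-square ∘ o₁) (triAdj-switching G d₁ o₁) ⟩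
  charPoly (referenceTriAdj G) ≡⟨ charPoly-switching (sgn ∘ o₂) (sgn-square ∘ o₂) (triAdj-switching G d₂ o₂) ⟨
  charPoly (triAdj G d₂ o₂)    ∎)
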